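{- Let $\{U_n\}_{n\ge0}$ be defined by $U_0=0$, $U_1=1$, $U_{n+2}=6U_{n+1}-U_n$. Say that a positive integer $m$ discriminates $U_0,\ldots,U_{n-1}$ if these integers are pairwise incongruent modulo $m$. Let $n\ge1$. (i) For $a\ge0$, the integer $m=2^a$ discriminates $U_0,\ldots,U_{n-1}$ if and only if $m\ge n$. (ii) For $a,b\ge1$, the integer $m=2^a\cdot5^b$ discriminates $U_0,\ldots,U_{n-1}$ if and only if $m\ge 5n/3$. -}

module Defs where

open import Data.Nat using (ℕ; zero; suc; _+_; _*_; _∸_; _<_; NonZero)
open import Data.Nat.DivMod using (_%_)
open import Relation.Binary.PropositionalEquality using (_≡_)

-- U 0 = 0, U 1 = 1, U (n+2) = 6 U (n+1) - U n.
-- The sequence is nonnegative and increasing (U (n+1) ≥ U n), so truncated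
-- subtraction on ℕ agrees with integer subtraction here.
U : ℕ → ℕ
U zero = 0
U (suc zero) = 1
U (suc (suc n)) = 6 * U (suc n) ∸ U n

Discriminates : (m : ℕ) → .{{NonZero m}} → ℕ → Set
Discriminates m n = ∀ i j → i < n → j < n → U i % m ≡ U j % m → i ≡ j

module Submission where

-- Work in ℤ with the solutions W (a , b) of w (n+2) = 6 w (n+1) - w n, so that
-- u = W (0 , 1) is the sequence U.  Call P a return time of u modulo m when u P ≡ 0 and
-- u (P+1) ≡ 1 (mod m), say u P = m x and u (P+1) = 1 + m z.  Then shifting any solution by P
-- adds m times another solution (its "derivative" D p), and iterating s times gives an expansion
-- to second order in m.  Two consequences drive everything:
--   * lift-return: if a prime q divides m, then q P is a return time modulo q m, with explicit
--     control of the new quotients;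
--   * lift-distinct: if moreover q never divides W (x , z), then u is pairwise incongruent modulo q m
--     below q P as soon as it is so modulo m below P.
-- A Certificate packages a return time, distinctness below it, and residue classes of x, z that
-- guarantee the non-divisibility at the next step.  Starting from computed base cases, this yields
-- the families (m , P) = (2^(a+1) , 2^(a+1)) and (10·2^a·5^b , 6·2^a·5^b).  Finally, a return time P
-- with distinctness below it means that m discriminates U 0, …, U (n-1) exactly when n ≤ P
-- (discriminates-iff), and 3·m = 5·P in the second family turns n ≤ P into 3 m ≥ 5 n.

open import Defs

module Recurrence where
  open import Data.Nat as ℕ using (ℕ; zero; suc)
  import Data.Nat.Properties as ℕₚ
  open import Data.Nat.Combinatorics using (_C_; nC1≡n; nCk+nC[k+1]≡[n+1]C[k+1])
  open import Data.Nat.DivMod using (_%_; _/_; m≡m%n+[m/n]*n; m%n<n; m<n*o⇒m/o<n)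
  open import Data.Nat.Divisibility as ℕ∣ using (>⇒∤; _∣0; n∣m⇒m%n≡0)
  open import Data.Nat.Primality using (Prime; euclidsLemma)
  open import Data.Integer using (ℤ; +_; -_; _+_; _-_; _*_; _⊖_; ∣_∣)
  import Data.Integer.Properties as ℤₚ
  open import Data.Integer.Divisibility.Signed using
    (_∣_; _∣?_; divides; ∣-trans; ∣m∣n⇒∣m+n; ∣m∣n⇒∣m-n; ∣n⇒∣m*n; ∣m⇒∣m*n; ∣m+n∣n⇒∣m; *-cancelˡ-∣; ∣ᵤ⇒∣; ∣⇒∣ᵤ)
  open import Data.Integer.Tactic.RingSolver using (solve-∀)
  open import Data.Product using (_×_; _,_; proj₁; proj₂; ∃-syntax)
  open import Data.Sum using (inj₁; inj₂; [_,_]′)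
  open import Function.Base using (_∘_)
  open import Function.Bundles using (_⇔_; mk⇔)
  open import Relation.Binary.PropositionalEquality
  open import Relation.Nullary using (¬_; Dec; yes; no; contradiction)
  open import Relation.Nullary.Decidable using (_→-dec_; ¬?)

  W : ℤ × ℤ → ℕ → ℤ
  W (a , b) zero          = a
  W (a , b) (suc zero)    = b
  W p       (suc (suc n)) = + 6 * W p (suc n) - W p n

  u : ℕ → ℤ
  u = W (+ 0 , + 1)

  -- U never decreases, so the truncated subtraction in its definition is exact …
  U-mono : ∀ n → U n ℕ.≤ U (suc n)
  U-mono zero    = ℕ.z≤n
  U-mono (suc n) = ℕₚ.m+n≤o⇒m≤o∸n (U (suc n))
    (ℕₚ.+-monoʳ-≤ (U (suc n)) (ℕₚ.≤-trans (U-mono n) (ℕₚ.m≤n*m (U (suc n)) 5)))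

  U≡u : ∀ n → + U n ≡ u n
  U≡u zero          = refl
  U≡u (suc zero)    = refl
  U≡u (suc (suc n)) = begin
    + (6 ℕ.* U (suc n) ℕ.∸ U n)       ≡⟨ sym (ℤₚ.⊖-≥ Un≤6U[n+1]) ⟩
    6 ℕ.* U (suc n) ⊖ U n            ≡⟨ sym (ℤₚ.[+m]-[+n]≡m⊖n (6 ℕ.* U (suc n)) (U n)) ⟩
    + (6 ℕ.* U (suc n)) - + U n        ≡⟨ cong₂ _-_ (ℤₚ.pos-* 6 (U (suc n))) refl ⟩
    + 6 * + U (suc n) - + U n          ≡⟨ cong₂ (λ v w → + 6 * v - w) (U≡u (suc n)) (U≡u n) ⟩
    + 6 * u (suc n) - u n              ∎
    where
    open ≡-Reasoning
    Un≤6U[n+1] : U n ℕ.≤ 6 ℕ.* U (suc n)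
    Un≤6U[n+1] = ℕₚ.≤-trans (U-mono n) (ℕₚ.m≤n*m (U (suc n)) 6)

  W-shift : ∀ p P n → W p (n ℕ.+ P) ≡ W (W p P , W p (suc P)) n
  W-shift p P zero          = refl
  W-shift p P (suc zero)    = refl
  W-shift p P (suc (suc n)) =
    cong₂ (λ v w → + 6 * v - w) (W-shift p P (suc n)) (W-shift p P n)

  W-linear : ∀ k a b a′ b′ n → W (a + k * a′ , b + k * b′) n ≡ W (a , b) n + k * W (a′ , b′) n
  W-linear k a b a′ b′ zero          = refl
  W-linear k a b a′ b′ (suc zero)    = refl
  W-linear k a b a′ b′ (suc (suc n)) = begin
    + 6 * W (a + k * a′ , b + k * b′) (suc n) - W (a + k * a′ , b + k * b′) n
      ≡⟨ cong₂ (λ v w → + 6 * v - w) (W-linear k a b a′ b′ (suc n)) (W-linear k a b a′ b′ n) ⟩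
    + 6 * (W (a , b) (suc n) + k * W (a′ , b′) (suc n)) - (W (a , b) n + k * W (a′ , b′) n)
      ≡⟨ step k (W (a , b) (suc n)) (W (a , b) n) (W (a′ , b′) (suc n)) (W (a′ , b′) n) ⟩
    W (a , b) (suc (suc n)) + k * W (a′ , b′) (suc (suc n)) ∎
    where
    open ≡-Reasoning
    step : ∀ k v w v′ w′ → + 6 * (v + k * v′) - (w + k * w′) ≡ (+ 6 * v - w) + k * (+ 6 * v′ - w′)
    step = solve-∀

  W-cong : ∀ {k} a b a′ b′ → k ∣ a - a′ → k ∣ b - b′ → ∀ n → k ∣ W (a , b) n - W (a′ , b′) n
  W-cong a b a′ b′ k∣a k∣b zero          = k∣a
  W-cong a b a′ b′ k∣a k∣b (suc zero)    = k∣b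
  W-cong {k} a b a′ b′ k∣a k∣b (suc (suc n)) =
    subst (k ∣_) (sym (step (W (a , b) (suc n)) (W (a , b) n) (W (a′ , b′) (suc n)) (W (a′ , b′) n)))
      (∣m∣n⇒∣m-n (∣n⇒∣m*n (+ 6) (W-cong a b a′ b′ k∣a k∣b (suc n))) (W-cong a b a′ b′ k∣a k∣b n))
    where
    step : ∀ v w v′ w′ → (+ 6 * v - w) - (+ 6 * v′ - w′) ≡ + 6 * (v - v′) - (w - w′)
    step = solve-∀

  W-via-u : ∀ a b n → W (a , b) n ≡ a * u (suc n) + (b - + 6 * a) * u n
  W-via-u a b zero          = at-0 a b
    where
    at-0 : ∀ a b → a ≡ a * + 1 + (b - + 6 * a) * + 0
    at-0 = solve-∀
  W-via-u a b (suc zero)    = at-1 a b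
    where
    at-1 : ∀ a b → b ≡ a * + 6 + (b - + 6 * a) * + 1
    at-1 = solve-∀
  W-via-u a b (suc (suc n)) =
    trans (cong₂ (λ v w → + 6 * v - w) (W-via-u a b (suc n)) (W-via-u a b n))
          (step a (b - + 6 * a) (u (suc (suc n))) (u (suc n)) (u n))
    where
    step : ∀ a c v w y → + 6 * (a * v + c * w) - (a * w + c * y) ≡ a * (+ 6 * v - w) + c * (+ 6 * w - y)
    step = solve-∀

  ∣-diff-sym : ∀ {k} a b → k ∣ a - b → k ∣ b - a
  ∣-diff-sym {k} a b k∣a-b = subst (k ∣_) (flip a b) (∣n⇒∣m*n (- + 1) k∣a-b)
    where
    flip : ∀ a b → - + 1 * (a - b) ≡ b - a
    flip = solve-∀

  ∣-diff-trans : ∀ {k} a b c → k ∣ a - b → k ∣ b - c → k ∣ a - c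
  ∣-diff-trans {k} a b c k∣a-b k∣b-c = subst (k ∣_) (chain a b c) (∣m∣n⇒∣m+n k∣a-b k∣b-c)
    where
    chain : ∀ a b c → (a - b) + (b - c) ≡ a - c
    chain = solve-∀

  ∣-diff-∣ : ∀ {k} a b → k ∣ a - b → k ∣ a → k ∣ b
  ∣-diff-∣ {k} a b k∣a-b k∣a = subst (k ∣_) (cancel a b) (∣m∣n⇒∣m-n k∣a k∣a-b)
    where
    cancel : ∀ a b → a - (a - b) ≡ b
    cancel = solve-∀

  prime-divisor : ∀ {q} a b → Prime q → ¬ + q ∣ b → + q ∣ a * b → + q ∣ a
  prime-divisor {q} a b q-prime q∤b q∣ab =
    [ ∣ᵤ⇒∣ , (λ q∣∣b∣ → contradiction (∣ᵤ⇒∣ q∣∣b∣) q∤b) ]′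
      (euclidsLemma ∣ a ∣ ∣ b ∣ q-prime (subst (q ℕ∣.∣_) (ℤₚ.abs-* a b) (∣⇒∣ᵤ q∣ab)))

  small-difference : ∀ {q s s′} → s ℕ.< q → s′ ℕ.< q → + q ∣ + s - + s′ → s ≡ s′
  small-difference {q} {s} {s′} s<q s′<q q∣ =
    ℤₚ.+-injective (ℤₚ.i-j≡0⇒i≡j (+ s) (+ s′) (ℤₚ.∣i∣≡0⇒i≡0 (multiple-below (∣⇒∣ᵤ q∣) distance<q)))
    where
    multiple-below : ∀ {d} → q ℕ∣.∣ d → d ℕ.< q → d ≡ 0
    multiple-below {zero}  _   _   = refl
    multiple-below {suc d} q∣d d<q = contradiction q∣d (>⇒∤ d<q)
    distance<q : ∣ + s - + s′ ∣ ℕ.< q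
    distance<q rewrite ℤₚ.[+m]-[+n]≡m⊖n s s′ with ℕₚ.≤-total s s′
    ... | inj₁ s≤s′ = subst (ℕ._< q) (sym (ℤₚ.∣⊖∣-≤ s≤s′)) (ℕₚ.≤-<-trans (ℕₚ.m∸n≤m s′ s) s′<q)
    ... | inj₂ s′≤s = subst (ℕ._< q) (sym (trans (ℤₚ.∣m⊖n∣≡∣n⊖m∣ s s′) (ℤₚ.∣⊖∣-≤ s′≤s)))
                            (ℕₚ.≤-<-trans (ℕₚ.m∸n≤m s s′) s<q)

  Distinct : ℕ → ℕ → Set
  Distinct m P = ∀ {i} → i ℕ.< P → ∀ {j} → j ℕ.< P → + m ∣ u i - u j → i ≡ j

  -- Distinctness is decidable, which settles the small base cases by computation.
  distinct? : ∀ m P → Dec (Distinct m P)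
  distinct? m P = ℕₚ.allUpTo? (λ i → ℕₚ.allUpTo? (λ j → (+ m ∣? u i - u j) →-dec (i ℕ.≟ j)) P) P

  record Return (m P : ℕ) : Set where
    constructor mkReturn
    field
      x z   : ℤ
      u-P   : u P ≡ + m * x
      u-P+1 : u (suc P) ≡ + 1 + + m * z

  module ReturnTime {m P : ℕ} (R : Return m P) where
    open Return R

    M : ℤ
    M = + m

    -- Initial values of the correction picked up by a solution over one period (see shift).
    D : ℤ × ℤ → ℤ × ℤ
    D (a , b) = (a * z + b * x - + 6 * a * x , b * z - a * x)

    -- Shifting by P adds M times the solution with initial values D p: by the closed form,
    -- W p P and W p (P+1) are the initial values of p changed by M · D p.
    shift : ∀ p n → W p (n ℕ.+ P) ≡ W p n + M * W (D p) n
    shift (a , b) n = begin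
      W (a , b) (n ℕ.+ P)                     ≡⟨ W-shift (a , b) P n ⟩
      W (W (a , b) P , W (a , b) (suc P)) n   ≡⟨ cong₂ (λ v w → W (v , w) n) at-P at-P+1 ⟩
      W (a + M * δa , b + M * δb) n           ≡⟨ W-linear M a b δa δb n ⟩
      W (a , b) n + M * W (D (a , b)) n       ∎
      where
      open ≡-Reasoning
      δa = a * z + b * x - + 6 * a * x
      δb = b * z - a * x
      at-P : W (a , b) P ≡ a + M * δa
      at-P = begin
        W (a , b) P                                  ≡⟨ W-via-u a b P ⟩
        a * u (suc P) + (b - + 6 * a) * u P          ≡⟨ cong₂ (λ v w → a * v + (b - + 6 * a) * w) u-P+1 u-P ⟩
        a * (+ 1 + M * z) + (b - + 6 * a) * (M * x)  ≡⟨ alg a b M x z ⟩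
        a + M * δa                                   ∎
        where
        alg : ∀ a b M x z → a * (+ 1 + M * z) + (b - + 6 * a) * (M * x) ≡ a + M * (a * z + b * x - + 6 * a * x)
        alg = solve-∀
      at-P+1 : W (a , b) (suc P) ≡ b + M * δb
      at-P+1 = begin
        W (a , b) (suc P)                                  ≡⟨ W-via-u a b (suc P) ⟩
        a * (+ 6 * u (suc P) - u P) + (b - + 6 * a) * u (suc P)
          ≡⟨ cong₂ (λ v w → a * (+ 6 * v - w) + (b - + 6 * a) * v) u-P+1 u-P ⟩
        a * (+ 6 * (+ 1 + M * z) - M * x) + (b - + 6 * a) * (+ 1 + M * z)  ≡⟨ alg a b M x z ⟩
        b + M * δb                                         ∎
        where
        alg : ∀ a b M x z → a * (+ 6 * (+ 1 + M * z) - M * x) + (b - + 6 * a) * (+ 1 + M * z) ≡ b + M * (b * z - a * x)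
        alg = solve-∀

    iterate : ∀ s p n → ∃[ V ] W p (n ℕ.+ s ℕ.* P)
                ≡ W p n + M * (+ s * W (D p) n + M * (+ (s C 2) * W (D (D p)) n + M * V))
    iterate zero p n = + 0 , trans (cong (W p) (ℕₚ.+-identityʳ n)) (alg (W p n) M (W (D p) n) (W (D (D p)) n))
      where
      alg : ∀ w M c d → w ≡ w + M * (+ 0 * c + M * (+ 0 * d + M * + 0))
      alg = solve-∀
    -- Step: apply the statement at n + P and expand each of its three terms by shift.
    iterate (suc s) p n with iterate s p (n ℕ.+ P)
    ... | V , after-s = + (s C 2) * w₃ + V , (begin
      W p (n ℕ.+ (P ℕ.+ s ℕ.* P))
        ≡⟨ cong (W p) (sym (ℕₚ.+-assoc n P (s ℕ.* P))) ⟩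
      W p (n ℕ.+ P ℕ.+ s ℕ.* P)
        ≡⟨ after-s ⟩
      W p (n ℕ.+ P) + M * (+ s * W (D p) (n ℕ.+ P) + M * (+ (s C 2) * W (D (D p)) (n ℕ.+ P) + M * V))
        ≡⟨ cong₂ (λ a b → a + M * (+ s * b + M * (+ (s C 2) * W (D (D p)) (n ℕ.+ P) + M * V)))
                 (shift p n) (shift (D p) n) ⟩
      (w₀ + M * w₁) + M * (+ s * (w₁ + M * w₂) + M * (+ (s C 2) * W (D (D p)) (n ℕ.+ P) + M * V))
        ≡⟨ cong (λ c → (w₀ + M * w₁) + M * (+ s * (w₁ + M * w₂) + M * (+ (s C 2) * c + M * V)))
                (shift (D (D p)) n) ⟩
      (w₀ + M * w₁) + M * (+ s * (w₁ + M * w₂) + M * (+ (s C 2) * (w₂ + M * w₃) + M * V))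
        ≡⟨ alg w₀ w₁ w₂ w₃ M (+ s) (+ (s C 2)) V ⟩
      w₀ + M * ((+ 1 + + s) * w₁ + M * ((+ s + + (s C 2)) * w₂ + M * (+ (s C 2) * w₃ + V)))
        ≡⟨ cong₂ (λ a b → w₀ + M * (a * w₁ + M * (b * w₂ + M * (+ (s C 2) * w₃ + V))))
                 (sym (ℤₚ.pos-+ 1 s)) (sym pairs-suc) ⟩
      w₀ + M * (+ suc s * w₁ + M * (+ (suc s C 2) * w₂ + M * (+ (s C 2) * w₃ + V))) ∎)
      where
      open ≡-Reasoning
      w₀ = W p n
      w₁ = W (D p) n
      w₂ = W (D (D p)) n
      w₃ = W (D (D (D p))) n
      pairs-suc : + (suc s C 2) ≡ + s + + (s C 2)
      pairs-suc = trans (cong +_ (trans (sym (nCk+nC[k+1]≡[n+1]C[k+1] s 1)) (cong (ℕ._+ s C 2) (nC1≡n s))))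
                        (ℤₚ.pos-+ s (s C 2))
      alg : ∀ w₀ w₁ w₂ w₃ M s t V →
            (w₀ + M * w₁) + M * (s * (w₁ + M * w₂) + M * (t * (w₂ + M * w₃) + M * V))
            ≡ w₀ + M * ((+ 1 + s) * w₁ + M * ((s + t) * w₂ + M * (t * w₃ + V)))
      alg = solve-∀

    periodic : ∀ p s n → M ∣ W p (n ℕ.+ s ℕ.* P) - W p n
    periodic p s n = divides E (trans (cong (_- W p n) (proj₂ (iterate s p n))) (alg (W p n) M E))
      where
      E = + s * W (D p) n + M * (+ (s C 2) * W (D (D p)) n + M * proj₁ (iterate s p n))
      alg : ∀ w M E → (w + M * E) - w ≡ E * M
      alg = solve-∀

    D-u : D (+ 0 , + 1) ≡ (x , z)
    D-u = cong₂ _,_ (alg₀ x z) (alg₁ x z)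
      where
      alg₀ : ∀ x z → + 0 * z + + 1 * x - + 6 * + 0 * x ≡ x
      alg₀ = solve-∀
      alg₁ : ∀ x z → + 1 * z - + 0 * x ≡ z
      alg₁ = solve-∀

    iterate-u : ∀ s n → ∃[ V ] u (n ℕ.+ s ℕ.* P)
                  ≡ u n + M * (+ s * W (x , z) n + M * (+ (s C 2) * W (D (x , z)) n + M * V))
    iterate-u s n = subst (λ c → ∃[ V ] u (n ℕ.+ s ℕ.* P)
                                   ≡ u n + M * (+ s * W c n + M * (+ (s C 2) * W (D c) n + M * V)))
                          D-u (iterate s (+ 0 , + 1) n)

    first-order : ∀ s r → ∃[ F ] u (r ℕ.+ s ℕ.* P) ≡ u r + M * (+ s * W (x , z) r) + M * M * F
    first-order s r = E , trans (proj₂ (iterate-u s r)) (alg (u r) M (+ s * W (x , z) r) E)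
      where
      E = + (s C 2) * W (D (x , z)) r + M * proj₁ (iterate-u s r)
      alg : ∀ a M b E → a + M * (b + M * E) ≡ a + M * b + M * M * E
      alg = solve-∀

    module _ .{{_ : ℕ.NonZero P}} where

      to-residue : ∀ p i → M ∣ W p i - W p (i % P)
      to-residue p i = subst (λ n → M ∣ W p n - W p (i % P)) (sym (m≡m%n+[m/n]*n i P))
                             (periodic p (i / P) (i % P))

      same-residue : Distinct m P → ∀ {i j} → M ∣ u i - u j → i % P ≡ j % P
      same-residue distinct {i} {j} M∣ = distinct (m%n<n i P) (m%n<n j P)
        (∣-diff-trans (u (i % P)) (u i) (u (j % P)) (∣-diff-sym (u i) (u (i % P)) (to-residue (+ 0 , + 1) i))
          (∣-diff-trans (u i) (u j) (u (j % P)) M∣ (to-residue (+ 0 , + 1) j)))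

    same-quotient : ∀ {q k} → Prime q → m ≡ q ℕ.* k → .{{_ : ℕ.NonZero m}} →
      (∀ n → ¬ + q ∣ W (x , z) n) →
      ∀ r {s s′} → s ℕ.< q → s′ ℕ.< q → + q * M ∣ u (r ℕ.+ s ℕ.* P) - u (r ℕ.+ s′ ℕ.* P) → s ≡ s′
    same-quotient {q} {k} q-prime m≡qk never r {s} {s′} s<q s′<q qM∣ = small-difference s<q s′<q q∣s-s′
      where
      c = W (x , z) r
      F  = proj₁ (first-order s r)
      F′ = proj₁ (first-order s′ r)
      alg₁ : ∀ a M s s′ c F F′ →
             (a + M * (s * c) + M * M * F) - (a + M * (s′ * c) + M * M * F′)
             ≡ M * ((s - s′) * c) + M * M * (F - F′)
      alg₁ = solve-∀
      alg₂ : ∀ M q k → M * (q * k) ≡ k * (q * M)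
      alg₂ = solve-∀
      difference : u (r ℕ.+ s ℕ.* P) - u (r ℕ.+ s′ ℕ.* P) ≡ M * ((+ s - + s′) * c) + M * M * (F - F′)
      difference = trans (cong₂ _-_ (proj₂ (first-order s r)) (proj₂ (first-order s′ r)))
                         (alg₁ (u r) M (+ s) (+ s′) c F F′)
      qM∣M² : + q * M ∣ M * M
      qM∣M² = divides (+ k) (trans (cong (M *_) (trans (cong +_ m≡qk) (ℤₚ.pos-* q k))) (alg₂ M (+ q) (+ k)))
      qM∣Mx : + q * M ∣ M * ((+ s - + s′) * c)
      qM∣Mx = ∣m+n∣n⇒∣m (subst (+ q * M ∣_) difference qM∣) (∣m⇒∣m*n (F - F′) qM∣M²)
      q∣x : + q ∣ (+ s - + s′) * c
      q∣x = *-cancelˡ-∣ M (subst (_∣ M * ((+ s - + s′) * c)) (ℤₚ.*-comm (+ q) M) qM∣Mx)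
      q∣s-s′ : + q ∣ + s - + s′
      q∣s-s′ = prime-divisor (+ s - + s′) c q-prime (never r) q∣x

    lift-distinct : ∀ {q k} → Prime q → m ≡ q ℕ.* k → .{{_ : ℕ.NonZero m}} → .{{_ : ℕ.NonZero P}} →
      (∀ n → ¬ + q ∣ W (x , z) n) → Distinct m P → Distinct (q ℕ.* m) (q ℕ.* P)
    lift-distinct {q} q-prime m≡qk never distinct {i} i<qP {j} j<qP qm∣ = begin
      i                        ≡⟨ m≡m%n+[m/n]*n i P ⟩
      i % P ℕ.+ (i / P) ℕ.* P  ≡⟨ cong₂ (λ r s → r ℕ.+ s ℕ.* P) residues quotients ⟩
      j % P ℕ.+ (j / P) ℕ.* P  ≡⟨ sym (m≡m%n+[m/n]*n j P) ⟩
      j                        ∎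
      where
      open ≡-Reasoning
      qM∣ : + q * M ∣ u i - u j
      qM∣ = subst (_∣ u i - u j) (ℤₚ.pos-* q m) qm∣
      residues : i % P ≡ j % P
      residues = same-residue distinct (∣-trans (divides (+ q) refl) qM∣)
      quotients : i / P ≡ j / P
      quotients = same-quotient q-prime m≡qk never (j % P)
        (m<n*o⇒m/o<n i<qP) (m<n*o⇒m/o<n j<qP)
        (subst₂ (λ a b → + q * M ∣ u a - u b)
          (trans (m≡m%n+[m/n]*n i P) (cong (ℕ._+ (i / P) ℕ.* P) residues)) (m≡m%n+[m/n]*n j P) qM∣)

    record Lifted (q k : ℕ) : Set where
      field
        return′ : Return (q ℕ.* m) (q ℕ.* P)
        V₀ V₁   : ℤ
        x′≡     : Return.x return′ ≡ x + + k * (+ (q C 2) * (x * z + z * x - + 6 * x * x) + M * V₀)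
        z′≡     : Return.z return′ ≡ z + + k * (+ (q C 2) * (z * z - x * x) + M * V₁)

    -- If m = q k then q P is a return time modulo q m: expand u (q P) and u (q P + 1) to second order.
    lift-return : ∀ q k → m ≡ q ℕ.* k → Lifted q k
    lift-return q k m≡qk = record
      { return′ = mkReturn x′ z′ u-qP u-qP+1 ; V₀ = V₀ ; V₁ = V₁ ; x′≡ = refl ; z′≡ = refl }
      where
      open ≡-Reasoning
      V₀ = proj₁ (iterate-u q 0)
      V₁ = proj₁ (iterate-u q 1)
      E₀ = + (q C 2) * (x * z + z * x - + 6 * x * x) + M * V₀
      E₁ = + (q C 2) * (z * z - x * x) + M * V₁
      x′ = x + + k * E₀
      z′ = z + + k * E₁
      M≡qk : M ≡ + q * + k
      M≡qk = trans (cong +_ m≡qk) (ℤₚ.pos-* q k)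
      -- with m = q k, the second-order term M² E is q m · k E
      alg : ∀ a M q k y E → a + M * (q * y + (q * k) * E) ≡ a + (q * M) * (y + k * E)
      alg = solve-∀
      u-qP : u (q ℕ.* P) ≡ + (q ℕ.* m) * x′
      u-qP = begin
        u (q ℕ.* P)                             ≡⟨ proj₂ (iterate-u q 0) ⟩
        + 0 + M * (+ q * x + M * E₀)            ≡⟨ cong (λ N → + 0 + M * (+ q * x + N * E₀)) M≡qk ⟩
        + 0 + M * (+ q * x + (+ q * + k) * E₀)  ≡⟨ alg (+ 0) M (+ q) (+ k) x E₀ ⟩
        + 0 + (+ q * M) * x′                    ≡⟨ ℤₚ.+-identityˡ _ ⟩
        (+ q * M) * x′                          ≡⟨ cong (_* x′) (sym (ℤₚ.pos-* q m)) ⟩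
        + (q ℕ.* m) * x′                        ∎
      u-qP+1 : u (suc (q ℕ.* P)) ≡ + 1 + + (q ℕ.* m) * z′
      u-qP+1 = begin
        u (suc (q ℕ.* P))                       ≡⟨ proj₂ (iterate-u q 1) ⟩
        + 1 + M * (+ q * z + M * E₁)            ≡⟨ cong (λ N → + 1 + M * (+ q * z + N * E₁)) M≡qk ⟩
        + 1 + M * (+ q * z + (+ q * + k) * E₁)  ≡⟨ alg (+ 1) M (+ q) (+ k) z E₁ ⟩
        + 1 + (+ q * M) * z′                    ≡⟨ cong (λ N → + 1 + N * z′) (sym (ℤₚ.pos-* q m)) ⟩
        + 1 + + (q ℕ.* m) * z′                  ∎

  never-divisible : ∀ {q R} → Return q R → .{{_ : ℕ.NonZero R}} → ∀ p →
    (∀ {k} → k ℕ.< R → ¬ + q ∣ W p k) → ∀ n → ¬ + q ∣ W p n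
  never-divisible {R = R} ret p avoids n q∣ =
    avoids (m%n<n n R) (∣-diff-∣ (W p n) (W p (n % R)) (ReturnTime.to-residue ret p n) q∣)

  avoids? : ∀ q R p → Dec (∀ {k} → k ℕ.< R → ¬ + q ∣ W p k)
  avoids? q R p = ℕₚ.allUpTo? (λ k → ¬? (+ q ∣? W p k)) R

  -- A return time P modulo m with u distinct below P, whose quotients x and z lie in the
  -- classes of x₀ and z₀ modulo N; the classes are what keeps the lifting going.
  record Certificate (N : ℕ) (x₀ z₀ : ℤ) (m P : ℕ) : Set where
    field
      return   : Return m P
      x-class  : + N ∣ Return.x return - x₀
      z-class  : + N ∣ Return.z return - z₀
      distinct : Distinct m P

  -- Distinctness lifts by lift-distinct, since
  -- q ∣ N makes W (x , z) ≡ W (x₀ , z₀) (mod q).  The classes survive because the changes of the quotients,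
  -- k·(q choose 2)·2x(z - 3x) and k·(q choose 2)·(z - x)(z + x) up to multiples of m, are divisible by N:
  -- that is what the two conditions on k·(q choose 2) say, given z - x ≡ z₀ - x₀ (mod N).
  lift-certificate : ∀ {N x₀ z₀ m P} q k → Prime q → .{{_ : ℕ.NonZero m}} → .{{_ : ℕ.NonZero P}} →
    m ≡ q ℕ.* k → N ℕ∣.∣ m → q ℕ∣.∣ N →
    N ℕ∣.∣ k ℕ.* (q C 2) ℕ.* 2 → N ℕ∣.∣ k ℕ.* (q C 2) ℕ.* ∣ z₀ - x₀ ∣ →
    (∀ n → ¬ + q ∣ W (x₀ , z₀) n) →
    Certificate N x₀ z₀ m P → Certificate N x₀ z₀ (q ℕ.* m) (q ℕ.* P)
  lift-certificate {N} {x₀} {z₀} q k q-prime m≡qk N∣m q∣N N∣kT2 N∣kTΔ never₀ cert = record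
    { return   = return′
    ; x-class  = subst (+ N ∣_) (sym (trans (cong (_- x₀) x′≡) (x-step x x₀ z K T M V₀)))
                   (∣m∣n⇒∣m+n (∣m∣n⇒∣m+n x-class (∣m⇒∣m*n (x * (z - + 3 * x)) (scaled (+ 2) N∣kT2)))
                               (∣m⇒∣m*n (K * V₀) N∣M))
    ; z-class  = subst (+ N ∣_) (sym (trans (cong (_- z₀) z′≡) (z-step x x₀ z z₀ K T M V₁)))
                   (∣m∣n⇒∣m+n (∣m∣n⇒∣m+n (∣m∣n⇒∣m+n z-class (∣m⇒∣m*n (z + x) (scaled (z₀ - x₀) N∣kTΔ)))
                                         (∣n⇒∣m*n (K * T * (z + x)) (∣m∣n⇒∣m-n z-class x-class)))
                               (∣m⇒∣m*n (K * V₁) N∣M))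
    ; distinct = lift-distinct q-prime m≡qk never distinct
    }
    where
    open Certificate cert
    open Return return
    open ReturnTime return
    open Lifted (lift-return q k m≡qk)
    K = + k
    T = + (q C 2)
    N∣M : + N ∣ M
    N∣M = ∣ᵤ⇒∣ N∣m
    scaled : ∀ c → N ℕ∣.∣ k ℕ.* (q C 2) ℕ.* ∣ c ∣ → + N ∣ K * T * c
    scaled c = ∣ᵤ⇒∣ ∘ subst (N ℕ∣.∣_)
      (sym (trans (ℤₚ.abs-* (K * T) c) (cong (ℕ._* ∣ c ∣) (ℤₚ.abs-* K T))))
    q∣N′ : + q ∣ + N
    q∣N′ = ∣ᵤ⇒∣ q∣N
    never : ∀ n → ¬ + q ∣ W (x , z) n
    never n q∣ = never₀ n (∣-diff-∣ (W (x , z) n) (W (x₀ , z₀) n)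
      (W-cong x z x₀ z₀ (∣-trans q∣N′ x-class) (∣-trans q∣N′ z-class) n) q∣)
    -- x′ - x₀ and z′ - z₀ split into summands that are visibly multiples of N.
    x-step : ∀ x x₀ z K T M V →
      (x + K * (T * (x * z + z * x - + 6 * x * x) + M * V)) - x₀
      ≡ ((x - x₀) + K * T * + 2 * (x * (z - + 3 * x))) + M * (K * V)
    x-step = solve-∀
    z-step : ∀ x x₀ z z₀ K T M V →
      (z + K * (T * (z * z - x * x) + M * V)) - z₀
      ≡ (((z - z₀) + K * T * (z₀ - x₀) * (z + x)) + (K * T * (z + x)) * ((z - z₀) - (x - x₀))) + M * (K * V)
    z-step = solve-∀

  %-equal⇒∣ : ∀ a b m .{{_ : ℕ.NonZero m}} → a % m ≡ b % m → + m ∣ + a - + b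
  %-equal⇒∣ a b m a≡b = divides (A - B) (begin
    + a - + b                                  ≡⟨ cong₂ _-_ (split a) (split b) ⟩
    (+ (a % m) + A * M) - (+ (b % m) + B * M)  ≡⟨ cong (λ r → (+ (a % m) + A * M) - (+ r + B * M)) (sym a≡b) ⟩
    (+ (a % m) + A * M) - (+ (a % m) + B * M)  ≡⟨ alg (+ (a % m)) A B M ⟩
    (A - B) * M                                ∎)
    where
    open ≡-Reasoning
    A = + (a / m)
    B = + (b / m)
    M = + m
    split : ∀ a → + a ≡ + (a % m) + + (a / m) * M
    split a = trans (cong +_ (m≡m%n+[m/n]*n a m))
                    (trans (ℤₚ.pos-+ (a % m) (a / m ℕ.* m)) (cong (_+_ (+ (a % m))) (ℤₚ.pos-* (a / m) m)))
    alg : ∀ r s t m → (r + s * m) - (r + t * m) ≡ (s - t) * m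
    alg = solve-∀

  -- If P ≥ 1 is a return time modulo m and u is distinct below P, then m discriminates
  -- U 0, …, U (n-1) exactly when n ≤ P: beyond P the values U P and U 0 collide.
  discriminates-iff : ∀ {m P} .{{_ : ℕ.NonZero m}} → 1 ℕ.≤ P → Return m P → Distinct m P →
    ∀ n → Discriminates m n ⇔ n ℕ.≤ P
  discriminates-iff {m} {P} 1≤P ret distinct n = mk⇔ only-if if
    where
    if : n ℕ.≤ P → Discriminates m n
    if n≤P i j i<n j<n same = distinct (ℕₚ.<-≤-trans i<n n≤P) (ℕₚ.<-≤-trans j<n n≤P)
      (subst₂ (λ a b → + m ∣ a - b) (U≡u i) (U≡u j) (%-equal⇒∣ (U i) (U j) m same))
    U[P]%m≡U[0]%m : U P % m ≡ U 0 % m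
    U[P]%m≡U[0]%m = trans (n∣m⇒m%n≡0 (U P) m (∣⇒∣ᵤ m∣U[P])) (sym (n∣m⇒m%n≡0 0 m (m ∣0)))
      where
      m∣U[P] : + m ∣ + U P
      m∣U[P] = divides (Return.x ret) (trans (U≡u P) (trans (Return.u-P ret) (ℤₚ.*-comm (+ m) (Return.x ret))))
    only-if : Discriminates m n → n ℕ.≤ P
    only-if disc with n ℕ.≤? P
    ... | yes n≤P = n≤P
    ... | no  n≰P = contradiction (sym (disc P 0 P<n (ℕₚ.≤-<-trans ℕ.z≤n P<n) U[P]%m≡U[0]%m)) (ℕₚ.<⇒≢ 1≤P)
      where
      P<n : P ℕ.< n
      P<n = ℕₚ.≰⇒> n≰P

module Families where
  open Recurrence
  open import Data.Nat using (zero; suc; _*_; _^_; NonZero)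
  open import Data.Nat.Properties using (*-assoc; *-comm; *-zeroʳ; m^n≢0; m*n≢0)
  open import Data.Nat.Divisibility using (divides; ∣-refl)
  open import Data.Nat.Primality using (Prime; prime?)
  open import Data.Nat.Tactic.RingSolver using (solve-∀)
  open import Data.Integer using (+_)
  import Data.Integer.Divisibility.Signed as ℤ
  open import Data.Product using (_,_)
  open import Relation.Binary.PropositionalEquality using (_≡_; refl; subst₂)
  open import Relation.Nullary using (¬_)
  open import Relation.Nullary.Decidable using (from-yes)

  2-prime : Prime 2
  2-prime = from-yes (prime? 2)

  5-prime : Prime 5
  5-prime = from-yes (prime? 5)

  -- u 2 = 2·3, u 3 = 1 + 2·17 and u 6 = 5·1386, u 7 = 1 + 5·8078.
  return-2 : Return 2 2
  return-2 = mkReturn (+ 3) (+ 17) refl refl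

  return-5 : Return 5 6
  return-5 = mkReturn (+ 1386) (+ 8078) refl refl

  -- The invariant classes never meet the primes used for lifting; by never-divisible this is a
  -- finite check over one return time modulo the prime.
  class-1-1-odd : ∀ n → ¬ + 2 ℤ.∣ W (+ 1 , + 1) n
  class-1-1-odd = never-divisible return-2 (+ 1 , + 1) (from-yes (avoids? 2 2 (+ 1 , + 1)))

  class-3-9-odd : ∀ n → ¬ + 2 ℤ.∣ W (+ 3 , + 9) n
  class-3-9-odd = never-divisible return-2 (+ 3 , + 9) (from-yes (avoids? 2 2 (+ 3 , + 9)))

  class-3-9-prime-to-5 : ∀ n → ¬ + 5 ℤ.∣ W (+ 3 , + 9) n
  class-3-9-prime-to-5 = never-divisible return-5 (+ 3 , + 9) (from-yes (avoids? 5 6 (+ 3 , + 9)))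

  certificate-2 : ∀ a → Certificate 2 (+ 1) (+ 1) (2 ^ suc a) (2 ^ suc a)
  certificate-2 zero    = record
    { return = return-2 ; x-class = ℤ.divides (+ 1) refl ; z-class = ℤ.divides (+ 8) refl
    ; distinct = from-yes (distinct? 2 2) }
  certificate-2 (suc a) = lift-certificate 2 k 2-prime refl (divides k (*-comm 2 k)) ∣-refl
    (divides (k * 1) refl) (divides 0 (*-zeroʳ (k * 1))) class-1-1-odd (certificate-2 a)
    where
    k = 2 ^ a
    instance
      m≢0 : NonZero (2 ^ suc a)
      m≢0 = m^n≢0 2 (suc a)

  into-second : ∀ q c A B → q * (c * (A * B)) ≡ c * (A * (q * B))
  into-second = solve-∀

  into-first : ∀ q c A B → q * (c * (A * B)) ≡ c * ((q * A) * B)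
  into-first = solve-∀

  swap : ∀ a b c → a * b * c ≡ a * c * b
  swap = solve-∀

  five-halves : ∀ K → 5 * K * 1 * 2 ≡ K * 10
  five-halves = solve-∀

  fifteen-halves : ∀ K → 5 * K * 1 * 6 ≡ 3 * K * 10
  fifteen-halves = solve-∀

  certificate-10 : ∀ a b → Certificate 10 (+ 3) (+ 9) (10 * (2 ^ a * 5 ^ b)) (6 * (2 ^ a * 5 ^ b))
  certificate-10 zero    zero    = record
    { return = mkReturn (+ 693) (+ 4039) refl refl ; x-class = ℤ.divides (+ 69) refl
    ; z-class = ℤ.divides (+ 403) refl ; distinct = from-yes (distinct? 10 6) }
  certificate-10 a       (suc b) =
    subst₂ (Certificate 10 (+ 3) (+ 9)) (into-second 5 10 (2 ^ a) (5 ^ b)) (into-second 5 6 (2 ^ a) (5 ^ b))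
      (lift-certificate 5 (2 * K) 5-prime (*-assoc 5 2 K) (divides K (*-comm 10 K)) (divides 2 refl)
         (divides (2 * K * 2) (swap (2 * K) 10 2)) (divides (2 * K * 6) (swap (2 * K) 10 6))
         class-3-9-prime-to-5 (certificate-10 a b))
    where
    K = 2 ^ a * 5 ^ b
    instance
      K≢0 : NonZero K
      K≢0 = m*n≢0 (2 ^ a) (5 ^ b) {{m^n≢0 2 a}} {{m^n≢0 5 b}}
      m≢0 : NonZero (10 * K)
      m≢0 = m*n≢0 10 K
      P≢0 : NonZero (6 * K)
      P≢0 = m*n≢0 6 K
  certificate-10 (suc a) zero    =
    subst₂ (Certificate 10 (+ 3) (+ 9)) (into-first 2 10 (2 ^ a) 1) (into-first 2 6 (2 ^ a) 1)
      (lift-certificate 2 (5 * K) 2-prime (*-assoc 2 5 K) (divides K (*-comm 10 K)) (divides 5 refl)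
         (divides K (five-halves K)) (divides (3 * K) (fifteen-halves K)) class-3-9-odd (certificate-10 a zero))
    where
    K = 2 ^ a * 1
    instance
      K≢0 : NonZero K
      K≢0 = m*n≢0 (2 ^ a) 1 {{m^n≢0 2 a}}
      m≢0 : NonZero (10 * K)
      m≢0 = m*n≢0 10 K
      P≢0 : NonZero (6 * K)
      P≢0 = m*n≢0 6 K

open import Data.Nat using (ℕ; _*_; _^_; _≤_; _≥_)
open import Data.Nat.Properties using (m*n≢0; m^n≢0)
open import Data.Product using (_×_)
open import Function.Bundles using (_⇔_)

open import Data.Nat using (suc; zero; z≤n; s≤s; >-nonZero⁻¹)
open import Data.Nat.Properties using (*-monoʳ-≤; *-cancelˡ-≤)
open import Data.Nat.Tactic.RingSolver using (solve-∀)
open import Data.Integer using (+_)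
open import Data.Product using (_,_)
open import Function.Bundles using (mk⇔)
open import Function.Construct.Composition using (_⇔-∘_)
open import Relation.Binary.PropositionalEquality using (_≡_; refl; sym; subst)
open import Relation.Nullary.Decidable using (from-yes)
open Recurrence using (mkReturn; Certificate; distinct?; discriminates-iff)
open Families using (certificate-2; certificate-10)

-- Part (i): 2^a is a return time modulo 2^a with u distinct below it (for a = 0 trivially,
-- since u 1 = 1 and u 2 = 1 + 5).
power-of-two-discriminates : (n a : ℕ) → Discriminates (2 ^ a) {{m^n≢0 2 a}} n ⇔ (2 ^ a ≥ n)
power-of-two-discriminates n zero    =
  discriminates-iff (s≤s z≤n) (mkReturn (+ 1) (+ 5) refl refl) (from-yes (distinct? 1 1)) n
power-of-two-discriminates n (suc a) =
  discriminates-iff {{m^n≢0 2 (suc a)}} (>-nonZero⁻¹ (2 ^ suc a) {{m^n≢0 2 (suc a)}}) return distinct n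
  where open Certificate (certificate-2 a)

-- Part (ii): m = 2^a·5^b = 10 K has the return time P = 6 K, and 3 m = 5 P.
two-five-discriminates : (n a b : ℕ) → 1 ≤ a → 1 ≤ b →
  Discriminates (2 ^ a * 5 ^ b) {{m*n≢0 (2 ^ a) (5 ^ b) {{m^n≢0 2 a}} {{m^n≢0 5 b}}}} n
    ⇔ (3 * (2 ^ a * 5 ^ b) ≥ 5 * n)
two-five-discriminates n (suc a) (suc b) _ _ =
  mk⇔ (λ n≤P → subst (5 * n ≤_) (sym 3m≡5P) (*-monoʳ-≤ 5 n≤P))
      (λ 5n≤3m → *-cancelˡ-≤ 5 (subst (5 * n ≤_) 3m≡5P 5n≤3m))
    ⇔-∘ discriminates-iff {{m≢0}} (>-nonZero⁻¹ (6 * K) {{P≢0}}) return distinct n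
  where
  K = 2 ^ a * 5 ^ b
  m≡10K : 10 * K ≡ 2 ^ suc a * 5 ^ suc b
  m≡10K = factor (2 ^ a) (5 ^ b)
    where
    factor : ∀ A B → 10 * (A * B) ≡ (2 * A) * (5 * B)
    factor = solve-∀
  3m≡5P : 3 * (2 ^ suc a * 5 ^ suc b) ≡ 5 * (6 * K)
  3m≡5P = thirds (2 ^ a) (5 ^ b)
    where
    thirds : ∀ A B → 3 * ((2 * A) * (5 * B)) ≡ 5 * (6 * (A * B))
    thirds = solve-∀
  m≢0 = m*n≢0 (2 ^ suc a) (5 ^ suc b) {{m^n≢0 2 (suc a)}} {{m^n≢0 5 (suc b)}}
  P≢0 = m*n≢0 6 K {{_}} {{m*n≢0 (2 ^ a) (5 ^ b) {{m^n≢0 2 a}} {{m^n≢0 5 b}}}}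
  open Certificate (subst (λ m → Certificate 10 (+ 3) (+ 9) m (6 * K)) m≡10K (certificate-10 a b))

-- The theorem.
lemma12 : (n : ℕ) → 1 ≤ n →
    ((a : ℕ) → Discriminates (2 ^ a) {{m^n≢0 2 a}} n ⇔ (2 ^ a ≥ n))
    × ((a b : ℕ) → 1 ≤ a → 1 ≤ b →
        Discriminates (2 ^ a * 5 ^ b) {{m*n≢0 (2 ^ a) (5 ^ b) {{m^n≢0 2 a}} {{m^n≢0 5 b}}}} n
          ⇔ (3 * (2 ^ a * 5 ^ b) ≥ 5 * n))
lemma12 n _ = power-of-two-discriminates n , two-five-discriminates n
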